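{- Let $\mathbb{K}$ be a field of characteristic zero and let $\delta=\frac{\partial}{\partial X}+Y\frac{\partial}{\partial Y}$ acting on $\mathbb{K}[X,Y]$. Let $M$ be a positive integer and $D_0,D_1,S_1,\dots,S_M$ nonnegative integers such that $$S_1+\cdots+S_M>(D_0+M)(D_1+1)-M.$$ Let $(\zeta_1,\eta_1),\dots,(\zeta_M,\eta_M)\in\mathbb{K}\times\mathbb{K}^*$ with $\zeta_1,\dots,\zeta_M$ pairwise distinct. Then there is no nonzero polynomial $P\in\mathbb{K}[X,Y]$ of degree at most $D_0$ in $X$ and at most $D_1$ in $Y$ such that $\delta^\sigma P(\zeta_\kappa,\eta_\kappa)=0$ for all $\kappa\in\{1,\dots,M\}$ and all $0\le\sigma<S_\kappa$. -}

module Defs where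

open import Level using (Level; _⊔_)
open import Data.Nat as ℕ using (ℕ; zero; suc)
open import Data.Fin using (Fin)
open import Data.Product using (Σ; ∃; ∃-syntax; _×_; _,_)
open import Relation.Nullary using (¬_)
open import Relation.Binary.PropositionalEquality using (_≡_)
open import Algebra.Bundles using (CommutativeRing; Semiring)

record Field (c ℓ : Level) : Set (Level.suc (c ⊔ ℓ)) where
  field
    commutativeRing : CommutativeRing c ℓ
  open CommutativeRing commutativeRing public
  field
    1≉0     : ¬ (1# ≈ 0#)
    inverse : ∀ x → ¬ (x ≈ 0#) → ∃[ y ] (x * y ≈ 1#)

module FieldDefs {c ℓ} (K : Field c ℓ) where
  open Field K public
  open import Algebra.Definitions.RawSemiring (Semiring.rawSemiring semiring) public using (_^_)
    renaming (_×_ to _·_)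

  CharZero : Set ℓ
  CharZero = ∀ (n : ℕ) → (n · 1#) ≈ 0# → n ≡ 0

  -- a polynomial in K[X,Y], given by its coefficient function: P i j = coefficient of X^i Y^j
  Poly : Set c
  Poly = ℕ → ℕ → Carrier

  DegBound : ℕ → ℕ → Poly → Set ℓ
  DegBound D₀ D₁ P = ∀ i j → (D₀ ℕ.< i ⊎' D₁ ℕ.< j) → P i j ≈ 0#
    where
    open import Data.Sum using () renaming (_⊎_ to _⊎'_)

  NonZeroPoly : Poly → Set ℓ
  NonZeroPoly P = ∃[ i ] ∃[ j ] ¬ (P i j ≈ 0#)

  -- δ = ∂/∂X + Y ∂/∂Y :  δ(X^i Y^j) = i X^(i-1) Y^j + j X^i Y^j
  δ : Poly → Poly
  δ P i j = (suc i · P (suc i) j) + (j · P i j)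

  δ^ : ℕ → Poly → Poly
  δ^ zero    P = P
  δ^ (suc σ) P = δ (δ^ σ P)

  Σ< : ℕ → (ℕ → Carrier) → Carrier
  Σ< zero    f = 0#
  Σ< (suc n) f = Σ< n f + f n

  eval : ℕ → ℕ → Poly → Carrier → Carrier → Carrier
  eval D₀ D₁ P x y = Σ< (suc D₀) λ i → Σ< (suc D₁) λ j → P i j * ((x ^ i) * (y ^ j))

sumFin : (M : ℕ) → (Fin M → ℕ) → ℕ
sumFin zero    S = 0
sumFin (suc M) S = S Fin.zero ℕ.+ sumFin M (λ k → S (Fin.suc k))
  where import Data.Fin as Fin

{-# OPTIONS --safe #-}
module Submission where

-- Let J be the set of Y-degrees j for which the coefficient P_j(X) of Y^j in P is nonzero, n = |J|.
-- On P_j(X) Y^j the operator δ acts as d/dX + j. Linear algebra gives a nontrivial combination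
-- L = Σ a(k,i) X^i δ^k P (k < n, i ≤ (n-1) D₀) whose coefficients of Y^j vanish for all j ∈ J except one, j₀.
-- L still vanishes to order S_κ - (n-1) at (ζ_κ, η_κ); as η_κ ≠ 0 its single column, of degree ≤ n D₀,
-- then has roots ζ_κ of total multiplicity Σ (S_κ - n + 1) > n D₀ for d/dX + j₀, so L = 0.
-- If m is the largest i with a(·,m) ≠ 0 and d_j the X-degree of P_j, the coefficient of X^(m + d_j) Y^j
-- in L is (Σ_k a(k,m) j^k) · P_j[d_j]. So the polynomial Σ_k a(k,m) T^k of degree < n has the n roots
-- j ∈ J, distinct in characteristic zero: a contradiction. Equality in K is not decidable, so all case
-- distinctions are made under double negation, which is harmless as the goal is ⊥.

open import Defs

module Counting where

  open import Data.Nat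
  open import Data.Nat.Properties
  open import Data.Fin using (Fin)
  import Data.Fin as Fin
  open import Relation.Binary.PropositionalEquality using (_≡_; refl)
  open import Data.Nat.Solver using (module +-*-Solver)
  open +-*-Solver
  open ≤-Reasoning

  sumFin-∸ : ∀ M (S : Fin M → ℕ) t → sumFin M S ≤ sumFin M (λ κ → S κ ∸ t) + M * t
  sumFin-∸ zero    S t = z≤n
  sumFin-∸ (suc M) S t = begin
    S₀ + sumFin M S₊                        ≤⟨ +-mono-≤ (m≤n+m∸n S₀ t) (sumFin-∸ M S₊ t) ⟩
    (t + (S₀ ∸ t)) + (sumFin M S₊∸ + M * t) ≡⟨ rearrange t (S₀ ∸ t) (sumFin M S₊∸) (M * t) ⟩
    (S₀ ∸ t + sumFin M S₊∸) + (t + M * t)   ∎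
    where
    S₀ : ℕ
    S₀ = S Fin.zero
    S₊ S₊∸ : Fin M → ℕ
    S₊  κ = S (Fin.suc κ)
    S₊∸ κ = S (Fin.suc κ) ∸ t
    rearrange : ∀ t a b m → (t + a) + (b + m) ≡ (a + b) + (t + m)
    rearrange = solve 4 (λ t a b m → (t :+ a) :+ (b :+ m) := (a :+ b) :+ (t :+ m)) refl

  column-count : ∀ D₀ D₁ M s → (D₀ + M) * (D₁ + 1) ∸ M < s → suc D₁ * (D₀ + M) < s + M
  column-count D₀ D₁ M s h = begin-strict
    suc D₁ * (D₀ + M)           ≡⟨ solve 3 (λ D₀ D₁ M → (con 1 :+ D₁) :* (D₀ :+ M) := (D₀ :+ M) :* (D₁ :+ con 1)) refl D₀ D₁ M ⟩
    (D₀ + M) * (D₁ + 1)         ≤⟨ m≤n+m∸n _ M ⟩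
    M + ((D₀ + M) * (D₁ + 1) ∸ M) ≡⟨ +-comm M _ ⟩
    (D₀ + M) * (D₁ + 1) ∸ M + M <⟨ +-monoˡ-< M h ⟩
    s + M                       ∎

  remaining-multiplicity : ∀ n d M s t → suc n * (d + M) < s + M → s ≤ t + M * n → n * d + d < t
  remaining-multiplicity n d M s t h s≤ = +-cancelʳ-< (M * n + M) (n * d + d) t (begin-strict
    (n * d + d) + (M * n + M) ≡⟨ solve 3 (λ n d M → (n :* d :+ d) :+ (M :* n :+ M) := (con 1 :+ n) :* (d :+ M)) refl n d M ⟩
    suc n * (d + M)           <⟨ h ⟩
    s + M                     ≤⟨ +-monoˡ-≤ M s≤ ⟩
    (t + M * n) + M           ≡⟨ +-assoc t (M * n) M ⟩
    t + (M * n + M)           ∎)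

  unknowns-exceed-equations : ∀ n d → suc (n * suc (n * d + d)) ≡ suc n * suc (n * d)
  unknowns-exceed-equations = solve 2 (λ n d → con 1 :+ n :* (con 1 :+ (n :* d :+ d)) := (con 1 :+ n) :* (con 1 :+ n :* d)) refl

  shifted-degree : ∀ i n d B → i ≤ n * d → suc n * d ≤ B → i + d ≤ B
  shifted-degree i n d B i≤ le = ≤-trans (≤-trans (+-monoˡ-≤ d i≤) (≤-reflexive (+-comm (n * d) d))) le

module ZeroEstimate {c ℓ} (K : Field c ℓ) where

  open import Level using (_⊔_)
  open import Data.Nat as ℕ using (ℕ; zero; suc; z≤n; s≤s; _∸_; _≤_; _<_)
  import Data.Nat.Properties as ℕₚ
  open import Data.Fin using (Fin)
  import Data.Fin as Fin
  open import Data.Product using (Σ; ∃; _×_; _,_; proj₁; proj₂)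
  open import Data.Product.Properties using (≡-dec)
  open import Data.Sum using (_⊎_; inj₁; inj₂; [_,_]; map₁; map₂)
  open import Data.Empty using (⊥; ⊥-elim)
  open import Data.Unit.Polymorphic using (⊤; tt)
  open import Data.List using (List; []; _∷_; length; _++_; map; cartesianProduct; applyUpTo; upTo; tabulate; filter)
  import Data.List.Properties as Listₚ
  open import Data.List.Membership.Propositional using (_∈_; _∉_; find; lose)
  open import Data.List.Membership.Propositional.Properties
    using (∈-cartesianProduct⁺; ∈-cartesianProduct⁻; ∈-upTo⁺; ∈-upTo⁻; ∈-filter⁺; ∈-filter⁻)
  open import Data.List.Membership.DecPropositional ℕ._≟_ using (_∈?_)
  open import Data.List.Relation.Unary.Any using (Any; here; there)
  import Data.List.Relation.Unary.Any as Any
  open import Data.List.Relation.Unary.All using (All; []; _∷_)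
  import Data.List.Relation.Unary.All as All
  import Data.List.Relation.Unary.All.Properties as Allₚ
  open import Data.List.Relation.Unary.AllPairs using (AllPairs; []; _∷_)
  import Data.List.Relation.Unary.AllPairs as AllPairs
  import Data.List.Relation.Unary.AllPairs.Properties as AllPairsₚ
  open import Data.List.Relation.Unary.Unique.Propositional using (Unique)
  import Data.List.Relation.Unary.Unique.Propositional.Properties as Uniqueₚ
  open import Relation.Nullary using (¬_; yes; no; Dec; ¬?; DoubleNegation)
  open import Relation.Nullary.Decidable using (¬¬-excluded-middle)
  open import Relation.Binary.Definitions using (DecidableEquality; tri<; tri≈; tri>)
  open import Relation.Binary.PropositionalEquality as ≡ using (_≡_; _≢_)

  open FieldDefs K
  open import Relation.Binary.Reasoning.Setoid setoid
  open import Algebra.Properties.Semiring.Mult semiring using (×-assoc-*; ×-comm-*; ×-assocˡ; ×-congˡ; ×-congʳ)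
  open import Algebra.Properties.CommutativeMonoid.Mult +-commutativeMonoid using (×-distrib-+)
  open import Algebra.Properties.CommutativeSemigroup +-commutativeSemigroup using () renaming (interchange to +-interchange)
  open import Algebra.Properties.CommutativeSemigroup *-commutativeSemigroup using (x∙yz≈y∙xz)
  open import Algebra.Properties.Ring ring using (-‿distribˡ-*; -‿distribʳ-*)
  open import Algebra.Properties.AbelianGroup +-abelianGroup using (∙-cancelˡ; x∙y⁻¹≈ε⇒x≈y; inverseˡ-unique; ε⁻¹≈ε; ⁻¹-∙-comm)
  open import Algebra.Solver.Ring.NaturalCoefficients.Default commutativeSemiring using (solve; _:=_; _:+_; _:*_; con)

  x*y≈0⇒x≈0 : ∀ {x y} → x * y ≈ 0# → ¬ y ≈ 0# → x ≈ 0#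
  x*y≈0⇒x≈0 {x} {y} xy≈0 y≉0 with inverse y y≉0
  ... | y⁻¹ , yy⁻¹≈1 = begin
    x              ≈⟨ sym (*-identityʳ x) ⟩
    x * 1#         ≈⟨ *-congˡ (sym yy⁻¹≈1) ⟩
    x * (y * y⁻¹)  ≈⟨ sym (*-assoc x y y⁻¹) ⟩
    (x * y) * y⁻¹  ≈⟨ *-congʳ xy≈0 ⟩
    0# * y⁻¹       ≈⟨ zeroˡ y⁻¹ ⟩
    0#             ∎

  y*x≈0⇒x≈0 : ∀ {x y} → y * x ≈ 0# → ¬ y ≈ 0# → x ≈ 0#
  y*x≈0⇒x≈0 {x} {y} yx≈0 = x*y≈0⇒x≈0 (trans (*-comm x y) yx≈0)

  x^n≉0 : ∀ {x} n → ¬ x ≈ 0# → ¬ x ^ n ≈ 0#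
  x^n≉0 zero    x≉0 = 1≉0
  x^n≉0 (suc n) x≉0 xxⁿ≈0 = x^n≉0 n x≉0 (y*x≈0⇒x≈0 xxⁿ≈0 x≉0)

  x-y≉0 : ∀ {x y} → ¬ x ≈ y → ¬ x - y ≈ 0#
  x-y≉0 x≉y x-y≈0 = x≉y (x∙y⁻¹≈ε⇒x≈y _ _ x-y≈0)

  ·≈·1#* : ∀ n x → n · x ≈ (n · 1#) * x
  ·≈·1#* n x = sym (trans (×-assoc-* n 1# x) (×-congʳ n (*-identityˡ x)))

  ·-zeroʳ : ∀ n → n · 0# ≈ 0#
  ·-zeroʳ n = trans (·≈·1#* n 0#) (zeroʳ _)

  module CharacteristicZero (char0 : CharZero) where

    suc·1#≉0 : ∀ n → ¬ suc n · 1# ≈ 0#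
    suc·1#≉0 n e with char0 (suc n) e
    ... | ()

    ·-cancel : ∀ n {x} → suc n · x ≈ 0# → x ≈ 0#
    ·-cancel n {x} e = y*x≈0⇒x≈0 (trans (sym (·≈·1#* (suc n) x)) e) (suc·1#≉0 n)

    ·1#-injective : ∀ m n → m · 1# ≈ n · 1# → m ≡ n
    ·1#-injective zero    zero    e = ≡.refl
    ·1#-injective zero    (suc n) e = ⊥-elim (suc·1#≉0 n (sym e))
    ·1#-injective (suc m) zero    e = ⊥-elim (suc·1#≉0 m e)
    ·1#-injective (suc m) (suc n) e = ≡.cong suc (·1#-injective m n (∙-cancelˡ 1# _ _ e))

  -- Finite sums

  Σ<-cong : ∀ n {f g : ℕ → Carrier} → (∀ i → i < n → f i ≈ g i) → Σ< n f ≈ Σ< n g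
  Σ<-cong zero    h = refl
  Σ<-cong (suc n) h = +-cong (Σ<-cong n (λ i i<n → h i (ℕₚ.m<n⇒m<1+n i<n))) (h n ℕₚ.≤-refl)

  Σ<-zero : ∀ n {f : ℕ → Carrier} → (∀ i → i < n → f i ≈ 0#) → Σ< n f ≈ 0#
  Σ<-zero zero    h = refl
  Σ<-zero (suc n) h = trans (+-cong (Σ<-zero n (λ i i<n → h i (ℕₚ.m<n⇒m<1+n i<n))) (h n ℕₚ.≤-refl)) (+-identityˡ 0#)

  Σ<-+ : ∀ n (f g : ℕ → Carrier) → Σ< n (λ i → f i + g i) ≈ Σ< n f + Σ< n g
  Σ<-+ zero    f g = sym (+-identityˡ 0#)
  Σ<-+ (suc n) f g = trans (+-congʳ (Σ<-+ n f g)) (+-interchange _ _ _ _)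

  Σ<-*ˡ : ∀ n a (f : ℕ → Carrier) → Σ< n (λ i → a * f i) ≈ a * Σ< n f
  Σ<-*ˡ zero    a f = sym (zeroʳ a)
  Σ<-*ˡ (suc n) a f = trans (+-congʳ (Σ<-*ˡ n a f)) (sym (distribˡ a _ _))

  Σ<-*ʳ : ∀ n a (f : ℕ → Carrier) → Σ< n (λ i → f i * a) ≈ Σ< n f * a
  Σ<-*ʳ n a f = trans (Σ<-cong n (λ i _ → *-comm (f i) a)) (trans (Σ<-*ˡ n a f) (*-comm a _))

  Σ<-shift : ∀ n (f : ℕ → Carrier) → Σ< (suc n) f ≈ f 0 + Σ< n (λ i → f (suc i))
  Σ<-shift zero    f = trans (+-identityˡ _) (sym (+-identityʳ _))
  Σ<-shift (suc n) f = trans (+-congʳ (Σ<-shift n f)) (+-assoc _ _ _)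

  Σ<-extend : ∀ n m (f : ℕ → Carrier) → n ≤ m → (∀ i → n ≤ i → f i ≈ 0#) → Σ< m f ≈ Σ< n f
  Σ<-extend n m f n≤m h = trans (reflexive (≡.cong (λ k → Σ< k f) (≡.sym (ℕₚ.m+[n∸m]≡n n≤m)))) (pad (m ∸ n))
    where
    pad : ∀ k → Σ< (n ℕ.+ k) f ≈ Σ< n f
    pad zero    = reflexive (≡.cong (λ k → Σ< k f) (ℕₚ.+-identityʳ n))
    pad (suc k) = begin
      Σ< (n ℕ.+ suc k) f          ≡⟨ ≡.cong (λ k → Σ< k f) (ℕₚ.+-suc n k) ⟩
      Σ< (n ℕ.+ k) f + f (n ℕ.+ k) ≈⟨ +-cong (pad k) (h _ (ℕₚ.m≤m+n n k)) ⟩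
      Σ< n f + 0#                 ≈⟨ +-identityʳ _ ⟩
      Σ< n f                      ∎

  Σ<-single : ∀ n m (f : ℕ → Carrier) → m < n → (∀ i → i < n → i ≢ m → f i ≈ 0#) → Σ< n f ≈ f m
  Σ<-single (suc n) m f m<n h with m ℕ.≟ n
  ... | yes ≡.refl = trans (+-congʳ (Σ<-zero n (λ i i<n → h i (ℕₚ.m<n⇒m<1+n i<n) (ℕₚ.<⇒≢ i<n)))) (+-identityˡ _)
  ... | no m≢n = trans (+-cong (Σ<-single n m f (ℕₚ.≤∧≢⇒< (ℕₚ.≤-pred m<n) m≢n) (λ i i<n → h i (ℕₚ.m<n⇒m<1+n i<n)))
                               (h n ℕₚ.≤-refl (λ e → m≢n (≡.sym e))))
                       (+-identityʳ _)

  ΣL : ∀ {I : Set} → List I → (I → Carrier) → Carrier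
  ΣL []       f = 0#
  ΣL (x ∷ xs) f = f x + ΣL xs f

  ΣL-cong : ∀ {I : Set} (xs : List I) {f g : I → Carrier} → (∀ x → x ∈ xs → f x ≈ g x) → ΣL xs f ≈ ΣL xs g
  ΣL-cong []       h = refl
  ΣL-cong (x ∷ xs) h = +-cong (h x (here ≡.refl)) (ΣL-cong xs (λ y y∈ → h y (there y∈)))

  ΣL-zero : ∀ {I : Set} (xs : List I) {f : I → Carrier} → (∀ x → x ∈ xs → f x ≈ 0#) → ΣL xs f ≈ 0#
  ΣL-zero xs {f} h = trans (ΣL-cong xs h) (zeros xs)
    where
    zeros : ∀ ys → ΣL ys (λ _ → 0#) ≈ 0#
    zeros []       = refl
    zeros (y ∷ ys) = trans (+-identityˡ _) (zeros ys)

  ΣL-+ : ∀ {I : Set} (xs : List I) (f g : I → Carrier) → ΣL xs (λ x → f x + g x) ≈ ΣL xs f + ΣL xs g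
  ΣL-+ []       f g = sym (+-identityˡ 0#)
  ΣL-+ (x ∷ xs) f g = trans (+-congˡ (ΣL-+ xs f g)) (+-interchange _ _ _ _)

  ΣL-*ˡ : ∀ {I : Set} (xs : List I) a (f : I → Carrier) → ΣL xs (λ x → a * f x) ≈ a * ΣL xs f
  ΣL-*ˡ []       a f = sym (zeroʳ a)
  ΣL-*ˡ (x ∷ xs) a f = trans (+-congˡ (ΣL-*ˡ xs a f)) (sym (distribˡ a _ _))

  ΣL-*ʳ : ∀ {I : Set} (xs : List I) a (f : I → Carrier) → ΣL xs (λ x → f x * a) ≈ ΣL xs f * a
  ΣL-*ʳ xs a f = trans (ΣL-cong xs (λ x _ → *-comm (f x) a)) (trans (ΣL-*ˡ xs a f) (*-comm a _))

  ΣL-neg : ∀ {I : Set} (xs : List I) (f : I → Carrier) → ΣL xs (λ x → - f x) ≈ - ΣL xs f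
  ΣL-neg []       f = sym ε⁻¹≈ε
  ΣL-neg (x ∷ xs) f = trans (+-congˡ (ΣL-neg xs f)) (⁻¹-∙-comm _ _)

  ΣL-++ : ∀ {I : Set} (xs ys : List I) f → ΣL (xs ++ ys) f ≈ ΣL xs f + ΣL ys f
  ΣL-++ []       ys f = sym (+-identityˡ _)
  ΣL-++ (x ∷ xs) ys f = trans (+-congˡ (ΣL-++ xs ys f)) (sym (+-assoc _ _ _))

  ΣL-map : ∀ {I J : Set} (g : I → J) (xs : List I) f → ΣL (map g xs) f ≈ ΣL xs (λ x → f (g x))
  ΣL-map g []       f = refl
  ΣL-map g (x ∷ xs) f = +-congˡ (ΣL-map g xs f)

  ΣL-cartesianProduct : ∀ {I J : Set} (xs : List I) (ys : List J) f →
                        ΣL (cartesianProduct xs ys) f ≈ ΣL xs (λ x → ΣL ys (λ y → f (x , y)))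
  ΣL-cartesianProduct []       ys f = refl
  ΣL-cartesianProduct (x ∷ xs) ys f =
    trans (ΣL-++ (map (x ,_) ys) _ f) (+-cong (ΣL-map (x ,_) ys f) (ΣL-cartesianProduct xs ys f))

  ΣL-upTo : ∀ n f → ΣL (upTo n) f ≈ Σ< n f
  ΣL-upTo = shifted (λ i → i)
    where
    shifted : ∀ (g : ℕ → ℕ) n f → ΣL (applyUpTo g n) f ≈ Σ< n (λ i → f (g i))
    shifted g zero    f = refl
    shifted g (suc n) f = trans (+-congˡ (shifted (λ i → g (suc i)) n f)) (sym (Σ<-shift n _))

  length-cartesianProduct : ∀ {I J : Set} (xs : List I) (ys : List J) →
                            length (cartesianProduct xs ys) ≡ length xs ℕ.* length ys
  length-cartesianProduct []       ys = ≡.refl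
  length-cartesianProduct (x ∷ xs) ys = ≡.trans (Listₚ.length-++ (map (x ,_) ys))
    (≡.cong₂ ℕ._+_ (Listₚ.length-map (x ,_) ys) (length-cartesianProduct xs ys))

  -- Double negation and linear systems

  ¬¬-split : ∀ {p} {C : Set} (P : C → Set p) (cs : List C) →
             DoubleNegation ((∀ x → x ∈ cs → P x) ⊎ (∃ λ x → x ∈ cs × ¬ P x))
  ¬¬-split P []       k = k (inj₁ (λ x ()))
  ¬¬-split P (y ∷ cs) k = ¬¬-excluded-middle {A = P y} λ where
    (no ¬Py) → k (inj₂ (y , here ≡.refl , ¬Py))
    (yes Py) → ¬¬-split P cs λ where
      (inj₁ all)            → k (inj₁ λ { x (here ≡.refl) → Py ; x (there x∈) → all x x∈ })
      (inj₂ (x , x∈ , ¬Px)) → k (inj₂ (x , there x∈ , ¬Px))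

  ¬¬-∀∈ : ∀ {p} {I : Set} {Q : I → Set p} (xs : List I) →
          (∀ x → x ∈ xs → DoubleNegation (Q x)) → DoubleNegation (∀ x → x ∈ xs → Q x)
  ¬¬-∀∈ []       h k = k (λ x ())
  ¬¬-∀∈ (y ∷ xs) h k = h y (here ≡.refl) λ Qy → ¬¬-∀∈ xs (λ x x∈ → h x (there x∈)) λ all →
    k λ { x (here ≡.refl) → Qy ; x (there x∈) → all x x∈ }

  ¬¬-greatest-counterexample : ∀ {p} (Q : ℕ → Set p) t → ¬ (∀ i → i ≤ t → Q i) →
    DoubleNegation (∃ λ m → m ≤ t × ¬ Q m × (∀ i → m < i → i ≤ t → Q i))
  ¬¬-greatest-counterexample Q t not-all k = ¬¬-excluded-middle {A = Q t} λ where
      (no ¬Qt) → k (t , ℕₚ.≤-refl , ¬Qt , λ i t<i i≤t → ⊥-elim (ℕₚ.<⇒≱ t<i i≤t))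
      (yes Qt) → below t Qt not-all k
    where
    ≤suc⇒≤⊎≡ : ∀ {i t} → i ≤ suc t → i ≤ t ⊎ i ≡ suc t
    ≤suc⇒≤⊎≡ i≤ = map₁ ℕₚ.≤-pred (ℕₚ.m≤n⇒m<n∨m≡n i≤)
    below : ∀ t → Q t → ¬ (∀ i → i ≤ t → Q i) →
            DoubleNegation (∃ λ m → m ≤ t × ¬ Q m × (∀ i → m < i → i ≤ t → Q i))
    below zero    Q0 not-all _ = not-all λ { zero _ → Q0 }
    below (suc t) Qt not-all k = ¬¬-greatest-counterexample Q t
      (λ all → not-all λ i i≤ → [ all i , (λ { ≡.refl → Qt }) ] (≤suc⇒≤⊎≡ i≤))
      λ (m , m≤t , ¬Qm , above) → k (m , ℕₚ.m≤n⇒m≤1+n m≤t , ¬Qm , λ i m<i i≤ →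
        [ above i m<i , (λ { ≡.refl → Qt }) ] (≤suc⇒≤⊎≡ i≤))

  remove : ∀ {C : Set} {x : C} (cs : List C) → x ∈ cs →
           ∃ λ cs′ → length cs ≡ suc (length cs′) × (∀ y → y ∈ cs → y ≡ x ⊎ y ∈ cs′)
  remove (y ∷ cs) (here ≡.refl) = cs , ≡.refl , λ { z (here e) → inj₁ e ; z (there z∈) → inj₂ z∈ }
  remove (y ∷ cs) (there x∈) with remove cs x∈
  ... | cs′ , len , mem = y ∷ cs′ , ≡.cong suc len , λ
    { z (here e) → inj₂ (here e)
    ; z (there z∈) → map₂ there (mem z z∈) }

  NontrivialSolution : {I C : Set} → List C → List I → (I → C → Carrier) → Set (c ⊔ ℓ)
  NontrivialSolution {I} cs us φ =
    Σ (I → Carrier) λ a → Any (λ u → ¬ a u ≈ 0#) us × (∀ x → x ∈ cs → ΣL us (λ u → a u * φ u x) ≈ 0#)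

  module LinearSystem {I C : Set} (_≟_ : DecidableEquality I) where

    update : I → Carrier → (I → Carrier) → I → Carrier
    update u α a x with x ≟ u
    ... | yes _ = α
    ... | no  _ = a x

    update-≡ : ∀ u α a → update u α a u ≡ α
    update-≡ u α a with u ≟ u
    ... | yes _ = ≡.refl
    ... | no ne = ⊥-elim (ne ≡.refl)

    update-≢ : ∀ u α a x → x ≢ u → update u α a x ≡ a x
    update-≢ u α a x ne with x ≟ u
    ... | yes e = ⊥-elim (ne e)
    ... | no  _ = ≡.refl

    -- Either the first unknown occurs in no equation, and alone gives a solution, or it is eliminated
    -- using an equation in which it occurs.
    ¬¬-nontrivial-solution : (cs : List C) (us : List I) → Unique us → length cs < length us →
                             (φ : I → C → Carrier) → DoubleNegation (NontrivialSolution cs us φ)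
    ¬¬-nontrivial-solution cs (u ∷ us) (u∉us ∷ unique) len φ k =
      ¬¬-split (λ x → φ u x ≈ 0#) cs λ where
        (inj₁ u-absent)          → k (solution-at-u u-absent)
        (inj₂ (x₀ , x₀∈ , φ≉0)) → eliminate x₀ x₀∈ φ≉0
      where
      ≢u : ∀ {x} → x ∈ us → x ≢ u
      ≢u x∈ ≡.refl = All.lookup u∉us x∈ ≡.refl

      solution-at-u : (∀ x → x ∈ cs → φ u x ≈ 0#) → NontrivialSolution cs (u ∷ us) φ
      solution-at-u u-absent = a , here (λ a≈0 → 1≉0 (trans (reflexive (≡.sym (update-≡ u 1# _))) a≈0)) , λ x x∈ →
        trans (+-cong (trans (*-congʳ (reflexive (update-≡ u 1# _))) (trans (*-identityˡ _) (u-absent x x∈)))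
                      (ΣL-zero us (λ v v∈ → trans (*-congʳ (reflexive (update-≢ u 1# _ v (≢u v∈)))) (zeroˡ _))))
              (+-identityˡ 0#)
        where
        a : I → Carrier
        a = update u 1# (λ _ → 0#)

      eliminate : ∀ x₀ → x₀ ∈ cs → ¬ φ u x₀ ≈ 0# → ⊥
      eliminate x₀ x₀∈ π≉0 with inverse (φ u x₀) π≉0 | remove cs x₀∈
      ... | π⁻¹ , ππ⁻¹≈1 | cs′ , len-cs , mem =
        ¬¬-nontrivial-solution cs′ us unique len′ φ′ λ (a′ , nonzero′ , solves′) →
          k (a a′ , nonzero a′ nonzero′ , solves a′ solves′)
        where
        π : Carrier
        π = φ u x₀
        len′ : length cs′ < length us
        len′ = ℕₚ.≤-pred (≡.subst (_< length (u ∷ us)) len-cs len)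
        φ′ : I → C → Carrier
        φ′ x y = φ x y - (φ x x₀ * π⁻¹) * φ u y
        α : (I → Carrier) → Carrier
        α a′ = - (ΣL us (λ v → a′ v * φ v x₀) * π⁻¹)
        a : (I → Carrier) → I → Carrier
        a a′ = update u (α a′) a′

        nonzero : ∀ a′ → Any (λ v → ¬ a′ v ≈ 0#) us → Any (λ v → ¬ a a′ v ≈ 0#) (u ∷ us)
        nonzero a′ nz with find nz
        ... | v , v∈ , a′v≉0 = there (lose v∈ (λ e → a′v≉0 (trans (reflexive (≡.sym (update-≢ u _ a′ v (≢u v∈)))) e)))

        pivot-eliminated : ∀ x → φ′ x x₀ ≈ 0#
        pivot-eliminated x = begin
          φ x x₀ - (φ x x₀ * π⁻¹) * π ≈⟨ +-congˡ (-‿cong (trans (*-assoc _ _ _) (trans (*-congˡ (trans (*-comm π⁻¹ π) ππ⁻¹≈1)) (*-identityʳ _)))) ⟩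
          φ x x₀ - φ x x₀             ≈⟨ -‿inverseʳ _ ⟩
          0#                          ∎

        reduced-equation : ∀ a′ y → ΣL us (λ v → a′ v * φ′ v y) ≈ α a′ * φ u y + ΣL us (λ v → a′ v * φ v y)
        reduced-equation a′ y = begin
          ΣL us (λ v → a′ v * φ′ v y)
            ≈⟨ ΣL-cong us (λ v _ → trans (distribˡ _ _ _) (+-congˡ (trans (sym (-‿distribʳ-* _ _)) (-‿cong (regroup (a′ v) (φ v x₀) π⁻¹ (φ u y)))))) ⟩
          ΣL us (λ v → a′ v * φ v y + - ((a′ v * φ v x₀) * (π⁻¹ * φ u y)))
            ≈⟨ ΣL-+ us _ _ ⟩
          ΣL us (λ v → a′ v * φ v y) + ΣL us (λ v → - ((a′ v * φ v x₀) * (π⁻¹ * φ u y)))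
            ≈⟨ +-congˡ (trans (ΣL-neg us _) (-‿cong (ΣL-*ʳ us _ _))) ⟩
          ΣL us (λ v → a′ v * φ v y) + - (ΣL us (λ v → a′ v * φ v x₀) * (π⁻¹ * φ u y))
            ≈⟨ +-comm _ _ ⟩
          - (ΣL us (λ v → a′ v * φ v x₀) * (π⁻¹ * φ u y)) + ΣL us (λ v → a′ v * φ v y)
            ≈⟨ +-congʳ (trans (-‿cong (sym (*-assoc _ _ _))) (-‿distribˡ-* _ _)) ⟩
          α a′ * φ u y + ΣL us (λ v → a′ v * φ v y) ∎
          where
          regroup : ∀ p q r s → p * ((q * r) * s) ≈ (p * q) * (r * s)
          regroup = solve 4 (λ p q r s → p :* ((q :* r) :* s) := (p :* q) :* (r :* s)) refl

        solves : ∀ a′ → (∀ y → y ∈ cs′ → ΣL us (λ v → a′ v * φ′ v y) ≈ 0#) →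
                 ∀ y → y ∈ cs → ΣL (u ∷ us) (λ v → a a′ v * φ v y) ≈ 0#
        solves a′ solves′ y y∈ = begin
          a a′ u * φ u y + ΣL us (λ v → a a′ v * φ v y)
            ≈⟨ +-cong (*-congʳ (reflexive (update-≡ u _ a′))) (ΣL-cong us (λ v v∈ → *-congʳ (reflexive (update-≢ u _ a′ v (≢u v∈))))) ⟩
          α a′ * φ u y + ΣL us (λ v → a′ v * φ v y)
            ≈⟨ sym (reduced-equation a′ y) ⟩
          ΣL us (λ v → a′ v * φ′ v y)
            ≈⟨ by-membership (mem y y∈) ⟩
          0# ∎
          where
          by-membership : y ≡ x₀ ⊎ y ∈ cs′ → ΣL us (λ v → a′ v * φ′ v y) ≈ 0#
          by-membership (inj₁ ≡.refl) = ΣL-zero us (λ v _ → trans (*-congˡ (pivot-eliminated v)) (zeroʳ _))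
          by-membership (inj₂ y∈′)    = solves′ y y∈′

  -- Univariate polynomials and roots with multiplicity

  UPoly : Set c
  UPoly = ℕ → Carrier

  _≋_ : UPoly → UPoly → Set ℓ
  R ≋ R′ = ∀ i → R i ≈ R′ i

  Degree≤ : ℕ → UPoly → Set ℓ
  Degree≤ d R = ∀ i → d < i → R i ≈ 0#

  -- δ₁ b = d/dX + b, the action of δ on R(X) Y^b (see δ^-column).
  δ₁ : ℕ → UPoly → UPoly
  δ₁ b R i = (suc i · R (suc i)) + (b · R i)

  δ₁^ : ℕ → ℕ → UPoly → UPoly
  δ₁^ b zero    R = R
  δ₁^ b (suc σ) R = δ₁ b (δ₁^ b σ R)

  eval₁ : ℕ → UPoly → Carrier → Carrier
  eval₁ B R x = Σ< (suc B) (λ i → R i * x ^ i)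

  mulX : UPoly → UPoly
  mulX R zero    = 0#
  mulX R (suc i) = R i

  mulXPlus : Carrier → UPoly → UPoly
  mulXPlus w R i = mulX R i + w * R i

  ·-comm : ∀ m n x → m · (n · x) ≈ n · (m · x)
  ·-comm m n x = trans (×-assocˡ x m n) (trans (×-congˡ (ℕₚ.*-comm m n)) (sym (×-assocˡ x n m)))

  δ₁-cong : ∀ b {R R′} → R ≋ R′ → δ₁ b R ≋ δ₁ b R′
  δ₁-cong b e i = +-cong (×-congʳ (suc i) (e (suc i))) (×-congʳ b (e i))

  δ₁^-cong : ∀ b σ {R R′} → R ≋ R′ → δ₁^ b σ R ≋ δ₁^ b σ R′
  δ₁^-cong b zero    e = e
  δ₁^-cong b (suc σ) e = δ₁-cong b (δ₁^-cong b σ e)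

  δ₁^-suc : ∀ b σ R → δ₁^ b σ (δ₁ b R) ≋ δ₁^ b (suc σ) R
  δ₁^-suc b zero    R i = refl
  δ₁^-suc b (suc σ) R   = δ₁-cong b (δ₁^-suc b σ R)

  δ₁-Degree≤ : ∀ b d {R} → Degree≤ d R → Degree≤ d (δ₁ b R)
  δ₁-Degree≤ b d {R} h i d<i =
    trans (+-cong (trans (×-congʳ (suc i) (h (suc i) (ℕₚ.m<n⇒m<1+n d<i))) (·-zeroʳ (suc i)))
                  (trans (×-congʳ b (h i d<i)) (·-zeroʳ b)))
          (+-identityˡ 0#)

  δ₁^-Degree≤ : ∀ b σ d {R} → Degree≤ d R → Degree≤ d (δ₁^ b σ R)
  δ₁^-Degree≤ b zero    d h = h
  δ₁^-Degree≤ b (suc σ) d h = δ₁-Degree≤ b d (δ₁^-Degree≤ b σ d h)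

  -- The top coefficient is only rescaled, since d/dX lowers the degree.
  δ₁^-top : ∀ b σ d R → Degree≤ d R → δ₁^ b σ R d ≈ (b · 1#) ^ σ * R d
  δ₁^-top b zero    d R h = sym (*-identityˡ _)
  δ₁^-top b (suc σ) d R h = begin
    (suc d · δ₁^ b σ R (suc d)) + (b · δ₁^ b σ R d)
      ≈⟨ +-cong (trans (×-congʳ (suc d) (δ₁^-Degree≤ b σ d h (suc d) ℕₚ.≤-refl)) (·-zeroʳ (suc d))) (·≈·1#* b _) ⟩
    0# + (b · 1#) * δ₁^ b σ R d   ≈⟨ +-identityˡ _ ⟩
    (b · 1#) * δ₁^ b σ R d        ≈⟨ *-congˡ (δ₁^-top b σ d R h) ⟩
    (b · 1#) * ((b · 1#) ^ σ * R d) ≈⟨ sym (*-assoc _ _ _) ⟩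
    (b · 1#) ^ suc σ * R d        ∎

  δ₁-+ : ∀ b (F H : UPoly) → δ₁ b (λ i → F i + H i) ≋ (λ i → δ₁ b F i + δ₁ b H i)
  δ₁-+ b F H i = trans (+-cong (×-distrib-+ _ _ (suc i)) (×-distrib-+ _ _ b)) (+-interchange _ _ _ _)

  δ₁-· : ∀ b n (F : UPoly) → δ₁ b (λ i → n · F i) ≋ (λ i → n · δ₁ b F i)
  δ₁-· b n F i = trans (+-cong (·-comm (suc i) n _) (·-comm b n _)) (sym (×-distrib-+ _ _ n))

  δ₁-mulXPlus : ∀ b w H → δ₁ b (mulXPlus w H) ≋ (λ i → H i + mulXPlus w (δ₁ b H) i)
  δ₁-mulXPlus b w H zero = begin
    (1 · (H 0 + w * H 1)) + (b · (0# + w * H 0))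
      ≈⟨ +-cong (·≈·1#* 1 _) (·≈·1#* b _) ⟩
    (1# + 0#) * (H 0 + w * H 1) + (b · 1#) * (0# + w * H 0)
      ≈⟨ rearrange (H 0) (H 1) w (b · 1#) ⟩
    H 0 + (0# + w * ((1# + 0#) * H 1 + (b · 1#) * H 0))
      ≈⟨ +-congˡ (+-congˡ (*-congˡ (sym (+-cong (·≈·1#* 1 _) (·≈·1#* b _))))) ⟩
    H 0 + (0# + w * ((1 · H 1) + (b · H 0))) ∎
    where
    rearrange : ∀ h₀ h₁ w β → (1# + 0#) * (h₀ + w * h₁) + β * (0# + w * h₀) ≈ h₀ + (0# + w * ((1# + 0#) * h₁ + β * h₀))
    rearrange = solve 4 (λ h₀ h₁ w β → (con 1 :+ con 0) :* (h₀ :+ w :* h₁) :+ β :* (con 0 :+ w :* h₀)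
                                     := h₀ :+ (con 0 :+ w :* ((con 1 :+ con 0) :* h₁ :+ β :* h₀))) refl
  δ₁-mulXPlus b w H (suc i) = begin
    (suc (suc i) · (H (suc i) + w * H (suc (suc i)))) + (b · (H i + w * H (suc i)))
      ≈⟨ +-cong (·≈·1#* (suc (suc i)) _) (·≈·1#* b _) ⟩
    (1# + (suc i · 1#)) * (H (suc i) + w * H (suc (suc i))) + (b · 1#) * (H i + w * H (suc i))
      ≈⟨ rearrange (H i) (H (suc i)) (H (suc (suc i))) w (suc i · 1#) (b · 1#) ⟩
    H (suc i) + (((suc i · 1#) * H (suc i) + (b · 1#) * H i) + w * ((1# + (suc i · 1#)) * H (suc (suc i)) + (b · 1#) * H (suc i)))
      ≈⟨ +-congˡ (+-cong (sym (+-cong (·≈·1#* (suc i) _) (·≈·1#* b _))) (*-congˡ (sym (+-cong (·≈·1#* (suc (suc i)) _) (·≈·1#* b _))))) ⟩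
    H (suc i) + (((suc i · H (suc i)) + (b · H i)) + w * ((suc (suc i) · H (suc (suc i))) + (b · H (suc i)))) ∎
    where
    rearrange : ∀ h₀ h₁ h₂ w α β → (1# + α) * (h₁ + w * h₂) + β * (h₀ + w * h₁) ≈ h₁ + ((α * h₁ + β * h₀) + w * ((1# + α) * h₂ + β * h₁))
    rearrange = solve 6 (λ h₀ h₁ h₂ w α β → (con 1 :+ α) :* (h₁ :+ w :* h₂) :+ β :* (h₀ :+ w :* h₁)
                                         := h₁ :+ ((α :* h₁ :+ β :* h₀) :+ w :* ((con 1 :+ α) :* h₂ :+ β :* h₁))) refl

  δ₁^-mulXPlus : ∀ b w G σ → δ₁^ b (suc σ) (mulXPlus w G) ≋ (λ i → (suc σ · δ₁^ b σ G i) + mulXPlus w (δ₁^ b (suc σ) G) i)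
  δ₁^-mulXPlus b w G zero i = trans (δ₁-mulXPlus b w G i) (+-congʳ (sym (+-identityʳ (G i))))
  δ₁^-mulXPlus b w G (suc σ) i = begin
    δ₁ b (δ₁^ b (suc σ) (mulXPlus w G)) i               ≈⟨ δ₁-cong b (δ₁^-mulXPlus b w G σ) i ⟩
    δ₁ b (λ j → (suc σ · A j) + mulXPlus w B j) i         ≈⟨ δ₁-+ b (λ j → suc σ · A j) (mulXPlus w B) i ⟩
    δ₁ b (λ j → suc σ · A j) i + δ₁ b (mulXPlus w B) i    ≈⟨ +-cong (δ₁-· b (suc σ) A i) (δ₁-mulXPlus b w B i) ⟩
    (suc σ · B i) + (B i + mulXPlus w (δ₁ b B) i)          ≈⟨ sym (+-assoc _ _ _) ⟩
    ((suc σ · B i) + B i) + mulXPlus w (δ₁ b B) i          ≈⟨ +-congʳ (+-comm _ _) ⟩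
    (B i + (suc σ · B i)) + mulXPlus w (δ₁ b B) i          ∎
    where
    A B : UPoly
    A = δ₁^ b σ G
    B = δ₁^ b (suc σ) G

  eval₁-cong : ∀ B {R R′} x → R ≋ R′ → eval₁ B R x ≈ eval₁ B R′ x
  eval₁-cong B x e = Σ<-cong (suc B) (λ i _ → *-congʳ (e i))

  eval₁-+ : ∀ B (R R′ : UPoly) x → eval₁ B (λ i → R i + R′ i) x ≈ eval₁ B R x + eval₁ B R′ x
  eval₁-+ B R R′ x = trans (Σ<-cong (suc B) (λ i _ → distribʳ _ _ _)) (Σ<-+ (suc B) _ _)

  eval₁-· : ∀ B n (R : UPoly) x → eval₁ B (λ i → n · R i) x ≈ n · eval₁ B R x
  eval₁-· B n R x = begin
    Σ< (suc B) (λ i → (n · R i) * x ^ i)          ≈⟨ Σ<-cong (suc B) (λ i _ → trans (*-congʳ (·≈·1#* n (R i))) (*-assoc _ _ _)) ⟩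
    Σ< (suc B) (λ i → (n · 1#) * (R i * x ^ i))   ≈⟨ Σ<-*ˡ (suc B) _ _ ⟩
    (n · 1#) * eval₁ B R x                        ≈⟨ sym (·≈·1#* n _) ⟩
    n · eval₁ B R x                               ∎

  eval₁-mulX : ∀ B (H : UPoly) x → H B ≈ 0# → eval₁ B (mulX H) x ≈ x * eval₁ B H x
  eval₁-mulX B H x H[B]≈0 = begin
    Σ< (suc B) (λ i → mulX H i * x ^ i)   ≈⟨ Σ<-shift B _ ⟩
    0# * 1# + Σ< B (λ i → H i * x ^ suc i) ≈⟨ +-cong (zeroˡ 1#) (Σ<-cong B (λ i _ → x∙yz≈y∙xz (H i) x (x ^ i))) ⟩
    0# + Σ< B (λ i → x * (H i * x ^ i))   ≈⟨ +-identityˡ _ ⟩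
    Σ< B (λ i → x * (H i * x ^ i))        ≈⟨ Σ<-*ˡ B x _ ⟩
    x * Σ< B (λ i → H i * x ^ i)          ≈⟨ *-congˡ (sym (trans (+-congˡ (trans (*-congʳ H[B]≈0) (zeroˡ _))) (+-identityʳ _))) ⟩
    x * eval₁ B H x                        ∎

  eval₁-mulXPlus : ∀ B w (H : UPoly) x → H B ≈ 0# → eval₁ B (mulXPlus w H) x ≈ (x + w) * eval₁ B H x
  eval₁-mulXPlus B w H x H[B]≈0 = begin
    eval₁ B (mulXPlus w H) x                          ≈⟨ eval₁-+ B (mulX H) (λ i → w * H i) x ⟩
    eval₁ B (mulX H) x + eval₁ B (λ i → w * H i) x    ≈⟨ +-cong (eval₁-mulX B H x H[B]≈0)
                                                                (trans (Σ<-cong (suc B) (λ i _ → *-assoc _ _ _)) (Σ<-*ˡ (suc B) w _)) ⟩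
    x * eval₁ B H x + w * eval₁ B H x                 ≈⟨ sym (distribʳ _ _ _) ⟩
    (x + w) * eval₁ B H x                              ∎

  eval₁-extend : ∀ B N R x → N ≤ B → Degree≤ N R → eval₁ B R x ≈ eval₁ N R x
  eval₁-extend B N R x N≤B h = Σ<-extend (suc N) (suc B) _ (s≤s N≤B) (λ i N<i → trans (*-congʳ (h i N<i)) (zeroˡ _))

  horner : UPoly → Carrier → ℕ → ℕ → Carrier
  horner R z zero    i = 0#
  horner R z (suc k) i = R (suc i) + z * horner R z k (suc i)

  quotient : ℕ → UPoly → Carrier → UPoly
  quotient N R z i = horner R z (N ∸ i) i

  horner-Σ< : ∀ R z k i → R i + z * horner R z k i ≈ Σ< (suc k) (λ t → R (i ℕ.+ t) * z ^ t)
  horner-Σ< R z zero i = begin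
    R i + z * 0#                ≈⟨ trans (+-congˡ (zeroʳ z)) (+-identityʳ _) ⟩
    R i                         ≈⟨ sym (*-identityʳ _) ⟩
    R i * 1#                    ≡⟨ ≡.cong (λ j → R j * 1#) (≡.sym (ℕₚ.+-identityʳ i)) ⟩
    R (i ℕ.+ 0) * 1#            ≈⟨ sym (+-identityˡ _) ⟩
    0# + R (i ℕ.+ 0) * 1#       ∎
  horner-Σ< R z (suc k) i = begin
    R i + z * (R (suc i) + z * horner R z k (suc i))
      ≈⟨ +-congˡ (*-congˡ (horner-Σ< R z k (suc i))) ⟩
    R i + z * Σ< (suc k) (λ t → R (suc i ℕ.+ t) * z ^ t)
      ≈⟨ +-congˡ (sym (Σ<-*ˡ (suc k) z _)) ⟩
    R i + Σ< (suc k) (λ t → z * (R (suc i ℕ.+ t) * z ^ t))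
      ≈⟨ +-cong (sym (trans (*-identityʳ _) (reflexive (≡.cong R (ℕₚ.+-identityʳ i)))))
                (Σ<-cong (suc k) (λ t _ → trans (x∙yz≈y∙xz z _ _) (*-congʳ (reflexive (≡.cong R (≡.sym (ℕₚ.+-suc i t))))))) ⟩
    R (i ℕ.+ 0) * 1# + Σ< (suc k) (λ t → R (i ℕ.+ suc t) * z ^ suc t)
      ≈⟨ sym (Σ<-shift (suc k) _) ⟩
    Σ< (suc (suc k)) (λ t → R (i ℕ.+ t) * z ^ t) ∎

  quotient-Degree≤ : ∀ N R z → Degree≤ N (quotient (suc N) R z)
  quotient-Degree≤ N R z i N<i rewrite ℕₚ.m≤n⇒m∸n≡0 N<i = refl

  factor-theorem : ∀ B N R z → N ≤ B → Degree≤ N R → eval₁ B R z ≈ 0# → R ≋ mulXPlus (- z) (quotient N R z)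
  factor-theorem B N R z N≤B h R[z]≈0 zero = begin
    R 0                            ≈⟨ inverseˡ-unique _ _ constant-term ⟩
    - (z * horner R z N 0)         ≈⟨ -‿distribˡ-* z _ ⟩
    - z * horner R z N 0           ≈⟨ sym (+-identityˡ _) ⟩
    0# + - z * quotient N R z 0    ∎
    where
    constant-term : R 0 + z * horner R z N 0 ≈ 0#
    constant-term = trans (horner-Σ< R z N 0) (trans (sym (eval₁-extend B N R z N≤B h)) R[z]≈0)
  factor-theorem B N R z N≤B h R[z]≈0 (suc i) with i ℕ.<? N
  ... | yes i<N = begin
    R (suc i)                                      ≈⟨ sym (trans (+-assoc _ _ _) (trans (+-congˡ (-‿inverseʳ _)) (+-identityʳ _))) ⟩
    (R (suc i) + z * Q (suc i)) + - (z * Q (suc i)) ≈⟨ +-cong (reflexive (≡.cong (λ k → horner R z k i) (≡.sym (∸-suc i<N))))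
                                                              (-‿distribˡ-* z _) ⟩
    Q i + - z * Q (suc i)                          ∎
    where
    Q : UPoly
    Q = quotient N R z
    ∸-suc : ∀ {N i} → i < N → N ∸ i ≡ suc (N ∸ suc i)
    ∸-suc {suc N} {zero}  _         = ≡.refl
    ∸-suc {suc N} {suc i} (s≤s i<N) = ∸-suc i<N
  ... | no i≮N = begin
    R (suc i)                       ≈⟨ h (suc i) (s≤s N≤i) ⟩
    0#                              ≈⟨ sym (+-identityʳ 0#) ⟩
    0# + 0#                         ≈⟨ sym (+-cong (Q≈0 N≤i) (trans (*-congˡ (Q≈0 (ℕₚ.m≤n⇒m≤1+n N≤i))) (zeroʳ _))) ⟩
    Q i + - z * Q (suc i)           ∎
    where
    Q : UPoly
    Q = quotient N R z
    N≤i : N ≤ i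
    N≤i = ℕₚ.≮⇒≥ i≮N
    Q≈0 : ∀ {j} → N ≤ j → Q j ≈ 0#
    Q≈0 {j} N≤j = reflexive (≡.cong (λ k → horner R z k j) (ℕₚ.m≤n⇒m∸n≡0 N≤j))

  RootOfOrder : ℕ → ℕ → UPoly → Carrier × ℕ → Set ℓ
  RootOfOrder B b R (z , t) = ∀ σ → σ < t → eval₁ B (δ₁^ b σ R) z ≈ 0#

  DistinctPoints : List (Carrier × ℕ) → Set (c ⊔ ℓ)
  DistinctPoints = AllPairs (λ p q → ¬ proj₁ p ≈ proj₁ q)

  totalOrder : List (Carrier × ℕ) → ℕ
  totalOrder []            = 0
  totalOrder ((_ , t) ∷ ps) = t ℕ.+ totalOrder ps

  module MultiplicityBound (char0 : CharZero) (b B : ℕ) where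

    open CharacteristicZero char0

    module DivideOut (N : ℕ) (N<B : suc N ≤ B) (R : UPoly) (deg : Degree≤ (suc N) R)
                     (z : Carrier) (R[z]≈0 : eval₁ B R z ≈ 0#) where

      G : UPoly
      G = quotient (suc N) R z

      G-Degree≤ : Degree≤ N G
      G-Degree≤ = quotient-Degree≤ N R z

      R≋[X-z]G : R ≋ mulXPlus (- z) G
      R≋[X-z]G = factor-theorem B (suc N) R z N<B deg R[z]≈0

      eval-R : ∀ x → eval₁ B R x ≈ (x - z) * eval₁ B G x
      eval-R x = trans (eval₁-cong B x R≋[X-z]G) (eval₁-mulXPlus B (- z) G x (G-Degree≤ B N<B))

      eval-δ₁^-R : ∀ σ x → eval₁ B (δ₁^ b (suc σ) R) x ≈ (suc σ · eval₁ B (δ₁^ b σ G) x) + (x - z) * eval₁ B (δ₁^ b (suc σ) G) x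
      eval-δ₁^-R σ x = begin
        eval₁ B (δ₁^ b (suc σ) R) x                      ≈⟨ eval₁-cong B x (δ₁^-cong b (suc σ) R≋[X-z]G) ⟩
        eval₁ B (δ₁^ b (suc σ) (mulXPlus (- z) G)) x     ≈⟨ eval₁-cong B x (δ₁^-mulXPlus b (- z) G σ) ⟩
        eval₁ B (λ i → (suc σ · δ₁^ b σ G i) + mulXPlus (- z) (δ₁^ b (suc σ) G) i) x
          ≈⟨ eval₁-+ B _ _ x ⟩
        eval₁ B (λ i → suc σ · δ₁^ b σ G i) x + eval₁ B (mulXPlus (- z) (δ₁^ b (suc σ) G)) x
          ≈⟨ +-cong (eval₁-· B (suc σ) _ x) (eval₁-mulXPlus B (- z) _ x (δ₁^-Degree≤ b (suc σ) N G-Degree≤ B N<B)) ⟩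
        (suc σ · eval₁ B (δ₁^ b σ G) x) + (x - z) * eval₁ B (δ₁^ b (suc σ) G) x ∎

      root-at-z : ∀ t → RootOfOrder B b R (z , suc t) → RootOfOrder B b G (z , t)
      root-at-z t root σ σ<t = ·-cancel σ (begin
        suc σ · eval₁ B (δ₁^ b σ G) z                                            ≈⟨ sym (+-identityʳ _) ⟩
        (suc σ · eval₁ B (δ₁^ b σ G) z) + 0#                                     ≈⟨ +-congˡ (sym (trans (*-congʳ (-‿inverseʳ z)) (zeroˡ _))) ⟩
        (suc σ · eval₁ B (δ₁^ b σ G) z) + (z - z) * eval₁ B (δ₁^ b (suc σ) G) z ≈⟨ sym (eval-δ₁^-R σ z) ⟩
        eval₁ B (δ₁^ b (suc σ) R) z                                              ≈⟨ root (suc σ) (s≤s σ<t) ⟩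
        0#                                                                       ∎)

      root-elsewhere : ∀ {x t} → ¬ x ≈ z → RootOfOrder B b R (x , t) → RootOfOrder B b G (x , t)
      root-elsewhere x≉z root zero    0<t = y*x≈0⇒x≈0 (trans (sym (eval-R _)) (root 0 0<t)) (x-y≉0 x≉z)
      root-elsewhere {x} x≉z root (suc σ) σ<t = y*x≈0⇒x≈0 (begin
        (x - z) * eval₁ B (δ₁^ b (suc σ) G) x
          ≈⟨ sym (+-identityˡ _) ⟩
        0# + (x - z) * eval₁ B (δ₁^ b (suc σ) G) x
          ≈⟨ +-congʳ (sym (trans (×-congʳ (suc σ) (root-elsewhere x≉z root σ (ℕₚ.<⇒≤ σ<t))) (·-zeroʳ (suc σ)))) ⟩
        (suc σ · eval₁ B (δ₁^ b σ G) x) + (x - z) * eval₁ B (δ₁^ b (suc σ) G) x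
          ≈⟨ sym (eval-δ₁^-R σ x) ⟩
        eval₁ B (δ₁^ b (suc σ) R) x
          ≈⟨ root (suc σ) σ<t ⟩
        0# ∎) (x-y≉0 x≉z)

    -- Each root is divided out once, lowering its order by one and the degree by one.
    many-roots⇒≋0 : ∀ N → N ≤ B → ∀ R → Degree≤ N R → ∀ ps → DistinctPoints ps → All (RootOfOrder B b R) ps →
                    N < totalOrder ps → R ≋ λ _ → 0#
    many-roots⇒≋0 N _ R _ [] _ _ ()
    many-roots⇒≋0 N N≤B R deg ((z , zero) ∷ ps) (_ ∷ distinct) (_ ∷ roots) N<order =
      many-roots⇒≋0 N N≤B R deg ps distinct roots N<order
    many-roots⇒≋0 zero N≤B R deg ((z , suc t) ∷ ps) _ (root ∷ _) _ zero = begin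
      R 0          ≈⟨ sym (trans (+-identityˡ _) (*-identityʳ _)) ⟩
      eval₁ 0 R z  ≈⟨ sym (eval₁-extend B 0 R z N≤B deg) ⟩
      eval₁ B R z  ≈⟨ root 0 (s≤s z≤n) ⟩
      0#           ∎
    many-roots⇒≋0 zero N≤B R deg ((z , suc t) ∷ ps) _ _ _ (suc i) = deg (suc i) (s≤s z≤n)
    many-roots⇒≋0 (suc N) N<B R deg ((z , suc t) ∷ ps) (z∉ps ∷ distinct) (root ∷ roots) (s≤s N<order) i = begin
      R i                     ≈⟨ R≋[X-z]G i ⟩
      mulX G i + - z * G i    ≈⟨ +-cong (mulX-zero i) (trans (*-congˡ (G≋0 i)) (zeroʳ _)) ⟩
      0# + 0#                 ≈⟨ +-identityʳ 0# ⟩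
      0#                      ∎
      where
      open DivideOut N N<B R deg z (root 0 (s≤s z≤n))
      G≋0 : G ≋ λ _ → 0#
      G≋0 = many-roots⇒≋0 N (ℕₚ.<⇒≤ N<B) G G-Degree≤ ((z , t) ∷ ps) (z∉ps ∷ distinct)
              (root-at-z t root ∷ All.zipWith (λ (rootₚ , p≉z) → root-elsewhere (λ e → p≉z (sym e)) rootₚ) (roots , z∉ps))
              N<order
      mulX-zero : ∀ i → mulX G i ≈ 0#
      mulX-zero zero    = refl
      mulX-zero (suc i) = G≋0 i

  ¬¬-degree : ∀ D R → Degree≤ D R → ¬ (R ≋ λ _ → 0#) →
              DoubleNegation (∃ λ d → d ≤ D × ¬ R d ≈ 0# × Degree≤ d R)
  ¬¬-degree D R deg R≉0 k =
    ¬¬-greatest-counterexample (λ i → R i ≈ 0#) D (λ low≈0 → R≉0 (λ i → ≈0 i (low≈0 i)))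
      λ (d , d≤D , R[d]≉0 , above) → k (d , d≤D , R[d]≉0 , λ i d<i → ≈0 i (above i d<i))
    where
    ≈0 : ∀ i → (i ≤ D → R i ≈ 0#) → R i ≈ 0#
    ≈0 i low≈0 with i ℕ.≤? D
    ... | yes i≤D = low≈0 i≤D
    ... | no  i≰D = deg i (ℕₚ.≰⇒> i≰D)

  -- Bivariate polynomials and vanishing

  _≋₂_ : Poly → Poly → Set ℓ
  Q ≋₂ Q′ = ∀ i j → Q i j ≈ Q′ i j

  DegreeX≤ : ℕ → Poly → Set ℓ
  DegreeX≤ d Q = ∀ i j → d < i → Q i j ≈ 0#

  column : ℕ → Poly → UPoly
  column j Q i = Q i j

  ColumnZero : ℕ → Poly → Set ℓ
  ColumnZero j Q = ∀ i → Q i j ≈ 0#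

  mulX₂ : Poly → Poly
  mulX₂ Q zero    j = 0#
  mulX₂ Q (suc i) j = Q i j

  mulX^ : ℕ → Poly → Poly
  mulX^ zero    Q = Q
  mulX^ (suc i) Q = mulX₂ (mulX^ i Q)

  _⊕_ : Poly → Poly → Poly
  (Q ⊕ Q′) i j = Q i j + Q′ i j

  scale : Carrier → Poly → Poly
  scale a Q i j = a * Q i j

  zeroPoly : Poly
  zeroPoly i j = 0#

  ΣP : ∀ {I : Set} → List I → (I → Poly) → Poly
  ΣP us f i j = ΣL us (λ u → f u i j)

  δ-cong : ∀ {Q Q′} → Q ≋₂ Q′ → δ Q ≋₂ δ Q′
  δ-cong e i j = δ₁-cong j (λ i → e i j) i

  δ^-cong : ∀ k {Q Q′} → Q ≋₂ Q′ → δ^ k Q ≋₂ δ^ k Q′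
  δ^-cong zero    e = e
  δ^-cong (suc k) e = δ-cong (δ^-cong k e)

  δ^-suc : ∀ k Q → δ^ k (δ Q) ≋₂ δ^ (suc k) Q
  δ^-suc zero    Q i j = refl
  δ^-suc (suc k) Q     = δ-cong (δ^-suc k Q)

  δ^-column : ∀ k j Q → column j (δ^ k Q) ≋ δ₁^ j k (column j Q)
  δ^-column zero    j Q i = refl
  δ^-column (suc k) j Q   = δ₁-cong j (δ^-column k j Q)

  δ-⊕ : ∀ Q Q′ → δ (Q ⊕ Q′) ≋₂ (δ Q ⊕ δ Q′)
  δ-⊕ Q Q′ i j = δ₁-+ j (column j Q) (column j Q′) i

  δ-scale : ∀ a Q → δ (scale a Q) ≋₂ scale a (δ Q)
  δ-scale a Q i j = trans (+-cong (sym (×-comm-* (suc i) a _)) (sym (×-comm-* j a _))) (sym (distribˡ a _ _))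

  δ-zeroPoly : δ zeroPoly ≋₂ zeroPoly
  δ-zeroPoly i j = trans (+-cong (·-zeroʳ (suc i)) (·-zeroʳ j)) (+-identityˡ 0#)

  δ-mulX₂ : ∀ Q → δ (mulX₂ Q) ≋₂ (Q ⊕ mulX₂ (δ Q))
  δ-mulX₂ Q zero    j = +-cong (+-identityʳ _) (·-zeroʳ j)
  δ-mulX₂ Q (suc i) j = +-assoc _ _ _

  δ-DegreeX≤ : ∀ d Q → DegreeX≤ d Q → DegreeX≤ d (δ Q)
  δ-DegreeX≤ d Q h i j = δ₁-Degree≤ j d (λ i → h i j) i

  δ^-DegreeX≤ : ∀ k d Q → DegreeX≤ d Q → DegreeX≤ d (δ^ k Q)
  δ^-DegreeX≤ zero    d Q h = h
  δ^-DegreeX≤ (suc k) d Q h = δ-DegreeX≤ d _ (δ^-DegreeX≤ k d Q h)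

  δ^-ColumnZero : ∀ k j Q → ColumnZero j Q → ColumnZero j (δ^ k Q)
  δ^-ColumnZero zero    j Q h = h
  δ^-ColumnZero (suc k) j Q h i =
    trans (+-cong (trans (×-congʳ (suc i) (δ^-ColumnZero k j Q h (suc i))) (·-zeroʳ (suc i)))
                  (trans (×-congʳ j (δ^-ColumnZero k j Q h i)) (·-zeroʳ j)))
          (+-identityˡ 0#)

  mulX^-DegreeX≤ : ∀ i d Q → DegreeX≤ d Q → DegreeX≤ (i ℕ.+ d) (mulX^ i Q)
  mulX^-DegreeX≤ zero    d Q h = h
  mulX^-DegreeX≤ (suc i) d Q h = shifted
    where
    shifted : DegreeX≤ (suc i ℕ.+ d) (mulX₂ (mulX^ i Q))
    shifted (suc e) j (s≤s i+d<e) = mulX^-DegreeX≤ i d Q h e j i+d<e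

  mulX^-+ : ∀ i e j Q → mulX^ i Q (i ℕ.+ e) j ≡ Q e j
  mulX^-+ zero    e j Q = ≡.refl
  mulX^-+ (suc i) e j Q = mulX^-+ i e j Q

  mulX^-ColumnZero : ∀ i j Q → ColumnZero j Q → ColumnZero j (mulX^ i Q)
  mulX^-ColumnZero zero    j Q h = h
  mulX^-ColumnZero (suc i) j Q h zero    = refl
  mulX^-ColumnZero (suc i) j Q h (suc e) = mulX^-ColumnZero i j Q h e

  eval-extend : ∀ d B B₁ Q x y → DegreeX≤ d Q → d ≤ B → eval d B₁ Q x y ≈ eval B B₁ Q x y
  eval-extend d B B₁ Q x y h d≤B =
    sym (Σ<-extend (suc d) (suc B) _ (s≤s d≤B) (λ i d<i → Σ<-zero (suc B₁) (λ j _ → trans (*-congʳ (h i j d<i)) (zeroˡ _))))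

  module Vanishing (B₀ B₁ : ℕ) (x y : Carrier) where

    E : Poly → Carrier
    E Q = eval B₀ B₁ Q x y

    row : Poly → ℕ → Carrier
    row Q i = Σ< (suc B₁) (λ j → Q i j * ((x ^ i) * (y ^ j)))

    eval-cong : ∀ {Q Q′} → Q ≋₂ Q′ → E Q ≈ E Q′
    eval-cong e = Σ<-cong (suc B₀) (λ i _ → Σ<-cong (suc B₁) (λ j _ → *-congʳ (e i j)))

    eval-⊕ : ∀ Q Q′ → E (Q ⊕ Q′) ≈ E Q + E Q′
    eval-⊕ Q Q′ = trans (Σ<-cong (suc B₀) (λ i _ → trans (Σ<-cong (suc B₁) (λ j _ → distribʳ _ _ _)) (Σ<-+ (suc B₁) _ _)))
                        (Σ<-+ (suc B₀) _ _)

    eval-scale : ∀ a Q → E (scale a Q) ≈ a * E Q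
    eval-scale a Q = trans (Σ<-cong (suc B₀) (λ i _ → trans (Σ<-cong (suc B₁) (λ j _ → *-assoc _ _ _)) (Σ<-*ˡ (suc B₁) a _)))
                           (Σ<-*ˡ (suc B₀) a _)

    eval-zeroPoly : E zeroPoly ≈ 0#
    eval-zeroPoly = Σ<-zero (suc B₀) (λ i _ → Σ<-zero (suc B₁) (λ j _ → zeroˡ _))

    eval-mulX₂ : ∀ Q → (∀ j → Q B₀ j ≈ 0#) → E (mulX₂ Q) ≈ x * E Q
    eval-mulX₂ Q top = begin
      Σ< (suc B₀) (row (mulX₂ Q))                        ≈⟨ Σ<-shift B₀ _ ⟩
      row (mulX₂ Q) 0 + Σ< B₀ (λ i → row (mulX₂ Q) (suc i)) ≈⟨ +-cong (Σ<-zero (suc B₁) (λ j _ → zeroˡ _)) (Σ<-cong B₀ (λ i _ → shifted-row i)) ⟩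
      0# + Σ< B₀ (λ i → x * row Q i)                     ≈⟨ trans (+-identityˡ _) (Σ<-*ˡ B₀ x _) ⟩
      x * Σ< B₀ (row Q)                                  ≈⟨ *-congˡ (sym (trans (+-congˡ (Σ<-zero (suc B₁) (λ j _ → trans (*-congʳ (top j)) (zeroˡ _))))
                                                                                (+-identityʳ _))) ⟩
      x * E Q                                            ∎
      where
      regroup : ∀ q x p r → q * ((x * p) * r) ≈ x * (q * (p * r))
      regroup = solve 4 (λ q x p r → q :* ((x :* p) :* r) := x :* (q :* (p :* r))) refl
      shifted-row : ∀ i → row (mulX₂ Q) (suc i) ≈ x * row Q i
      shifted-row i = trans (Σ<-cong (suc B₁) (λ j _ → regroup _ _ _ _)) (Σ<-*ˡ (suc B₁) x _)

    eval-column : ∀ j₀ Q → (∀ i j → j ≢ j₀ → Q i j ≈ 0#) → j₀ ≤ B₁ → E Q ≈ eval₁ B₀ (column j₀ Q) x * y ^ j₀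
    eval-column j₀ Q others≈0 j₀≤B₁ = begin
      E Q ≈⟨ Σ<-cong (suc B₀) (λ i _ → Σ<-single (suc B₁) j₀ _ (s≤s j₀≤B₁) (λ j _ j≢j₀ → trans (*-congʳ (others≈0 i j j≢j₀)) (zeroˡ _))) ⟩
      Σ< (suc B₀) (λ i → Q i j₀ * (x ^ i * y ^ j₀))   ≈⟨ Σ<-cong (suc B₀) (λ i _ → sym (*-assoc _ _ _)) ⟩
      Σ< (suc B₀) (λ i → (Q i j₀ * x ^ i) * y ^ j₀)   ≈⟨ Σ<-*ʳ (suc B₀) _ _ ⟩
      eval₁ B₀ (column j₀ Q) x * y ^ j₀               ∎

    VanishesTo : ℕ → Poly → Set ℓ
    VanishesTo zero    Q = ⊤
    VanishesTo (suc S) Q = E Q ≈ 0# × VanishesTo S (δ Q)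

    VanishesTo-cong : ∀ S {Q Q′} → Q ≋₂ Q′ → VanishesTo S Q → VanishesTo S Q′
    VanishesTo-cong zero    e _        = tt
    VanishesTo-cong (suc S) e (v₀ , v) = trans (sym (eval-cong e)) v₀ , VanishesTo-cong S (δ-cong e) v

    VanishesTo-⊕ : ∀ S Q Q′ → VanishesTo S Q → VanishesTo S Q′ → VanishesTo S (Q ⊕ Q′)
    VanishesTo-⊕ zero    Q Q′ _ _ = tt
    VanishesTo-⊕ (suc S) Q Q′ (v₀ , v) (v₀′ , v′) =
      trans (eval-⊕ Q Q′) (trans (+-cong v₀ v₀′) (+-identityˡ 0#)) ,
      VanishesTo-cong S (λ i j → sym (δ-⊕ Q Q′ i j)) (VanishesTo-⊕ S (δ Q) (δ Q′) v v′)

    VanishesTo-scale : ∀ S a Q → VanishesTo S Q → VanishesTo S (scale a Q)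
    VanishesTo-scale zero    a Q _        = tt
    VanishesTo-scale (suc S) a Q (v₀ , v) =
      trans (eval-scale a Q) (trans (*-congˡ v₀) (zeroʳ a)) ,
      VanishesTo-cong S (λ i j → sym (δ-scale a Q i j)) (VanishesTo-scale S a (δ Q) v)

    VanishesTo-zeroPoly : ∀ S → VanishesTo S zeroPoly
    VanishesTo-zeroPoly zero    = tt
    VanishesTo-zeroPoly (suc S) = eval-zeroPoly , VanishesTo-cong S (λ i j → sym (δ-zeroPoly i j)) (VanishesTo-zeroPoly S)

    VanishesTo-ΣP : ∀ {I : Set} S (us : List I) (f : I → Poly) → (∀ u → u ∈ us → VanishesTo S (f u)) → VanishesTo S (ΣP us f)
    VanishesTo-ΣP S []       f h = VanishesTo-zeroPoly S
    VanishesTo-ΣP S (u ∷ us) f h =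
      VanishesTo-⊕ S (f u) (ΣP us f) (h u (here ≡.refl)) (VanishesTo-ΣP S us f (λ v v∈ → h v (there v∈)))

    VanishesTo-mono : ∀ S S′ Q → S′ ≤ S → VanishesTo S Q → VanishesTo S′ Q
    VanishesTo-mono S       zero     Q _         _        = tt
    VanishesTo-mono (suc S) (suc S′) Q (s≤s S′≤S) (v₀ , v) = v₀ , VanishesTo-mono S S′ (δ Q) S′≤S v

    VanishesTo-δ^ : ∀ k S Q → VanishesTo S Q → VanishesTo (S ∸ k) (δ^ k Q)
    VanishesTo-δ^ zero    S       Q v        = v
    VanishesTo-δ^ (suc k) zero    Q _        = tt
    VanishesTo-δ^ (suc k) (suc S) Q (_ , v)  = VanishesTo-cong (S ∸ k) (δ^-suc k Q) (VanishesTo-δ^ k S (δ Q) v)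

    -- δ(XQ) = Q + X·δQ
    VanishesTo-mulX₂ : ∀ S d Q → DegreeX≤ d Q → d < B₀ → VanishesTo S Q → VanishesTo S (mulX₂ Q)
    VanishesTo-mulX₂ zero    d Q _ _ _ = tt
    VanishesTo-mulX₂ (suc S) d Q deg d<B₀ (v₀ , v) =
      trans (eval-mulX₂ Q (λ j → deg B₀ j d<B₀)) (trans (*-congˡ v₀) (zeroʳ x)) ,
      VanishesTo-cong S (λ i j → sym (δ-mulX₂ Q i j))
        (VanishesTo-⊕ S Q (mulX₂ (δ Q)) (VanishesTo-mono (suc S) S Q (ℕₚ.n≤1+n S) (v₀ , v))
                                        (VanishesTo-mulX₂ S d (δ Q) (δ-DegreeX≤ d Q deg) d<B₀ v))

    VanishesTo-mulX^ : ∀ S i d Q → DegreeX≤ d Q → i ℕ.+ d ≤ B₀ → VanishesTo S Q → VanishesTo S (mulX^ i Q)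
    VanishesTo-mulX^ S zero    d Q deg _   v = v
    VanishesTo-mulX^ S (suc i) d Q deg i+d<B₀ v =
      VanishesTo-mulX₂ S (i ℕ.+ d) (mulX^ i Q) (mulX^-DegreeX≤ i d Q deg) i+d<B₀ (VanishesTo-mulX^ S i d Q deg (ℕₚ.<⇒≤ i+d<B₀) v)

    VanishesTo⇒RootOfOrder : ∀ S j₀ Q → (∀ i j → j ≢ j₀ → Q i j ≈ 0#) → j₀ ≤ B₁ → ¬ y ≈ 0# → VanishesTo S Q →
                             RootOfOrder B₀ j₀ (column j₀ Q) (x , S)
    VanishesTo⇒RootOfOrder (suc S) j₀ Q others≈0 j₀≤B₁ y≉0 (v₀ , v) zero _ =
      x*y≈0⇒x≈0 (trans (sym (eval-column j₀ Q others≈0 j₀≤B₁)) v₀) (x^n≉0 j₀ y≉0)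
    VanishesTo⇒RootOfOrder (suc S) j₀ Q others≈0 j₀≤B₁ y≉0 (v₀ , v) (suc σ) (s≤s σ<S) = begin
      eval₁ B₀ (δ₁^ j₀ (suc σ) (column j₀ Q)) x ≈⟨ eval₁-cong B₀ x (λ i → sym (δ₁^-suc j₀ σ (column j₀ Q) i)) ⟩
      eval₁ B₀ (δ₁^ j₀ σ (column j₀ (δ Q))) x   ≈⟨ VanishesTo⇒RootOfOrder S j₀ (δ Q) δ-others≈0 j₀≤B₁ y≉0 v σ σ<S ⟩
      0#                                        ∎
      where
      δ-others≈0 : ∀ i j → j ≢ j₀ → δ Q i j ≈ 0#
      δ-others≈0 i j j≢j₀ = δ^-ColumnZero 1 j Q (λ i → others≈0 i j j≢j₀) i

    VanishesTo-from-eval : ∀ D₀ S P → DegreeX≤ D₀ P → D₀ ≤ B₀ →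
                           (∀ σ → σ < S → eval D₀ B₁ (δ^ σ P) x y ≈ 0#) → VanishesTo S P
    VanishesTo-from-eval D₀ zero    P deg D₀≤B₀ h = tt
    VanishesTo-from-eval D₀ (suc S) P deg D₀≤B₀ h =
      trans (sym (eval-extend D₀ B₀ B₁ P x y deg D₀≤B₀)) (h 0 (s≤s z≤n)) ,
      VanishesTo-from-eval D₀ S (δ P) (δ-DegreeX≤ D₀ P deg) D₀≤B₀
        (λ σ σ<S → trans (Σ<-cong (suc D₀) (λ i _ → Σ<-cong (suc B₁) (λ j _ → *-congʳ (δ^-suc σ P i j)))) (h (suc σ) (s≤s σ<S)))

  -- Elimination

  module Elimination (char0 : CharZero) (M D₀ D₁ B₀ : ℕ) (S : Fin M → ℕ) (ζ η : Fin M → Carrier)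
                     (η≉0 : ∀ κ → ¬ η κ ≈ 0#) (ζ-injective : ∀ κ κ′ → ζ κ ≈ ζ κ′ → κ ≡ κ′) where

    open CharacteristicZero char0
    module V (κ : Fin M) = Vanishing B₀ D₁ (ζ κ) (η κ)

    VanishesAtAll : Poly → Set ℓ
    VanishesAtAll P = ∀ κ → V.VanishesTo κ (S κ) P

    HasDegree : Poly → ℕ → Set ℓ
    HasDegree P j = ∃ λ d → d ≤ D₀ × ¬ P d j ≈ 0# × Degree≤ d (column j P)

    module Eliminate (j₀ : ℕ) (J′ : List ℕ) (unique : Unique (j₀ ∷ J′)) (J≤D₁ : ∀ j → j ∈ j₀ ∷ J′ → j ≤ D₁)
                     (nD₀≤B₀ : suc (length J′) ℕ.* D₀ ≤ B₀) (P : Poly) (deg : DegreeX≤ D₀ P)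
                     (support : ∀ i j → j ∉ j₀ ∷ J′ → P i j ≈ 0#) (degree : ∀ j → j ∈ j₀ ∷ J′ → HasDegree P j)
                     (vanishes : VanishesAtAll P) (count : suc (length J′) ℕ.* (D₀ ℕ.+ M) < sumFin M S ℕ.+ M) where

      J : List ℕ
      J = j₀ ∷ J′

      n′ n A : ℕ
      n′ = length J′
      n  = suc n′
      A  = n′ ℕ.* D₀

      -- Unknowns: the coefficients a (k , i) of X^i δ^k P; equations: the coefficients of X^e Y^j for j ≠ j₀.
      unknowns equations : List (ℕ × ℕ)
      unknowns  = cartesianProduct (upTo n) (upTo (suc A))
      equations = cartesianProduct J′ (upTo (suc (A ℕ.+ D₀)))

      term : ℕ × ℕ → Poly
      term (k , i) = mulX^ i (δ^ k P)

      coefficient : ℕ × ℕ → ℕ × ℕ → Carrier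
      coefficient u (j , e) = term u e j

      fewer-equations : length equations < length unknowns
      fewer-equations = ≡.subst₂ _<_ (≡.sym #equations) (≡.sym #unknowns) (ℕₚ.≤-reflexive (Counting.unknowns-exceed-equations n′ D₀))
        where
        #equations : length equations ≡ n′ ℕ.* suc (A ℕ.+ D₀)
        #equations = ≡.trans (length-cartesianProduct J′ (upTo (suc (A ℕ.+ D₀)))) (≡.cong (n′ ℕ.*_) (Listₚ.length-upTo _))
        #unknowns : length unknowns ≡ n ℕ.* suc A
        #unknowns = ≡.trans (length-cartesianProduct (upTo n) (upTo (suc A))) (≡.cong₂ ℕ._*_ (Listₚ.length-upTo n) (Listₚ.length-upTo _))

      ∈-unknowns⁻ : ∀ {k i} → (k , i) ∈ unknowns → k < n × i ≤ A
      ∈-unknowns⁻ u∈ with ∈-cartesianProduct⁻ (upTo n) (upTo (suc A)) u∈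
      ... | k∈ , i∈ = ∈-upTo⁻ k∈ , ℕₚ.≤-pred (∈-upTo⁻ i∈)

      A+D₀≤B₀ : A ℕ.+ D₀ ≤ B₀
      A+D₀≤B₀ = Counting.shifted-degree A n′ D₀ B₀ ℕₚ.≤-refl nD₀≤B₀

      term-DegreeX≤ : ∀ {u} → u ∈ unknowns → DegreeX≤ (A ℕ.+ D₀) (term u)
      term-DegreeX≤ {k , i} u∈ e j A+D₀<e =
        mulX^-DegreeX≤ i D₀ (δ^ k P) (δ^-DegreeX≤ k D₀ P deg) e j
          (ℕₚ.≤-<-trans (ℕₚ.+-monoˡ-≤ D₀ (proj₂ (∈-unknowns⁻ u∈))) A+D₀<e)

      module Solution (a : ℕ × ℕ → Carrier) (nontrivial : Any (λ u → ¬ a u ≈ 0#) unknowns)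
                      (solves : ∀ v → v ∈ equations → ΣL unknowns (λ u → a u * coefficient u v) ≈ 0#) where

        L : Poly
        L = ΣP unknowns (λ u → scale (a u) (term u))

        L-DegreeX≤ : DegreeX≤ (A ℕ.+ D₀) L
        L-DegreeX≤ e j A+D₀<e = ΣL-zero unknowns (λ u u∈ → trans (*-congˡ (term-DegreeX≤ u∈ e j A+D₀<e)) (zeroʳ _))

        L-other-columns : ∀ e j → j ≢ j₀ → L e j ≈ 0#
        L-other-columns e j j≢j₀ with j ∈? J′
        ... | no j∉J′ = ΣL-zero unknowns (λ (k , i) _ → trans (*-congˡ (mulX^-ColumnZero i j _ (δ^-ColumnZero k j P P[j]≈0) e)) (zeroʳ _))
          where
          P[j]≈0 : ColumnZero j P
          P[j]≈0 i = support i j (λ { (here j≡j₀) → j≢j₀ j≡j₀ ; (there j∈J′) → j∉J′ j∈J′ })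
        ... | yes j∈J′ with e ℕ.≤? A ℕ.+ D₀
        ...   | yes e≤ = solves (j , e) (∈-cartesianProduct⁺ j∈J′ (∈-upTo⁺ (s≤s e≤)))
        ...   | no  e≰ = L-DegreeX≤ e j (ℕₚ.≰⇒> e≰)

        L-vanishes : ∀ κ → V.VanishesTo κ (S κ ∸ n′) L
        L-vanishes κ = V.VanishesTo-ΣP κ (S κ ∸ n′) unknowns _ λ where
          (k , i) u∈ → let k<n , i≤A = ∈-unknowns⁻ u∈ in
            V.VanishesTo-scale κ _ (a (k , i)) _
              (V.VanishesTo-mulX^ κ (S κ ∸ n′) i D₀ (δ^ k P) (δ^-DegreeX≤ k D₀ P deg) (Counting.shifted-degree i n′ D₀ B₀ i≤A nD₀≤B₀)
                (V.VanishesTo-mono κ (S κ ∸ k) (S κ ∸ n′) _ (ℕₚ.∸-monoʳ-≤ (S κ) (ℕₚ.≤-pred k<n))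
                  (V.VanishesTo-δ^ κ k (S κ) P (vanishes κ))))

        L-column-j₀ : ColumnZero j₀ L
        L-column-j₀ = MultiplicityBound.many-roots⇒≋0 char0 j₀ B₀ (A ℕ.+ D₀) A+D₀≤B₀ (column j₀ L) (λ i → L-DegreeX≤ i j₀)
                        points distinct roots enough-roots
          where
          points : List (Carrier × ℕ)
          points = tabulate (λ κ → ζ κ , S κ ∸ n′)
          distinct : DistinctPoints points
          distinct = AllPairsₚ.tabulate⁺ (λ {κ} {κ′} κ≢κ′ ζ≈ζ′ → κ≢κ′ (ζ-injective κ κ′ ζ≈ζ′))
          roots : All (RootOfOrder B₀ j₀ (column j₀ L)) points
          roots = Allₚ.tabulate⁺ (λ κ → V.VanishesTo⇒RootOfOrder κ (S κ ∸ n′) j₀ L L-other-columns (J≤D₁ j₀ (here ≡.refl)) (η≉0 κ) (L-vanishes κ))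
          totalOrder-points : ∀ m (p : Fin m → Carrier × ℕ) → totalOrder (tabulate p) ≡ sumFin m (λ κ → proj₂ (p κ))
          totalOrder-points zero    p = ≡.refl
          totalOrder-points (suc m) p = ≡.cong (proj₂ (p Fin.zero) ℕ.+_) (totalOrder-points m (λ κ → p (Fin.suc κ)))
          enough-roots : A ℕ.+ D₀ < totalOrder points
          enough-roots = ≡.subst (A ℕ.+ D₀ <_) (≡.sym (totalOrder-points M _))
            (Counting.remaining-multiplicity n′ D₀ M (sumFin M S) _ count (Counting.sumFin-∸ M S n′))

        L≋0 : L ≋₂ zeroPoly
        L≋0 e j with j ℕ.≟ j₀
        ... | yes ≡.refl = L-column-j₀ e
        ... | no  j≢j₀   = L-other-columns e j j≢j₀

        RowZero : ℕ → Set ℓ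
        RowZero i = ∀ k → k < n → a (k , i) ≈ 0#

        not-all-RowZero : ¬ (∀ i → i ≤ A → RowZero i)
        not-all-RowZero all-zero with find nontrivial
        ... | (k , i) , u∈ , a≉0 = let k<n , i≤A = ∈-unknowns⁻ u∈ in a≉0 (all-zero i i≤A k k<n)

        -- Comparing the coefficients of X^(m+d) Y^j, where m is the top nonzero row of a and d the X-degree of
        -- column j, the polynomial Σₖ a (k , m) T^k vanishes at T = j for every column j.
        module TopRow (m : ℕ) (m≤A : m ≤ A) (row≉0 : ¬ RowZero m) (above : ∀ i → m < i → i ≤ A → RowZero i) where
          rowPoly : UPoly
          rowPoly k with k ℕ.<? n
          ... | yes _ = a (k , m)
          ... | no  _ = 0#

          rowPoly-< : ∀ k → k < n → rowPoly k ≡ a (k , m)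
          rowPoly-< k k<n with k ℕ.<? n
          ... | yes _   = ≡.refl
          ... | no  k≮n = ⊥-elim (k≮n k<n)

          rowPoly-Degree≤ : Degree≤ n′ rowPoly
          rowPoly-Degree≤ k n′<k with k ℕ.<? n
          ... | yes k<n = ⊥-elim (ℕₚ.<⇒≱ k<n n′<k)
          ... | no  _   = refl

          coefficient-formula : ∀ j d → Degree≤ d (column j P) → L (m ℕ.+ d) j ≈ eval₁ n′ rowPoly (j · 1#) * P d j
          coefficient-formula j d deg-j = begin
            L (m ℕ.+ d) j                                            ≈⟨ ΣL-cartesianProduct (upTo n) (upTo (suc A)) _ ⟩
            ΣL (upTo n) (λ k → ΣL (upTo (suc A)) (summand k))       ≈⟨ ΣL-upTo n _ ⟩
            Σ< n (λ k → ΣL (upTo (suc A)) (summand k))              ≈⟨ Σ<-cong n (λ k _ → ΣL-upTo (suc A) _) ⟩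
            Σ< n (λ k → Σ< (suc A) (summand k))                     ≈⟨ Σ<-cong n only-row-m ⟩
            Σ< n (λ k → a (k , m) * (x ^ k * P d j))                ≈⟨ Σ<-cong n (λ k k<n → trans (sym (*-assoc _ _ _))
                                                                         (*-congʳ (*-congʳ (reflexive (≡.sym (rowPoly-< k k<n)))))) ⟩
            Σ< n (λ k → (rowPoly k * x ^ k) * P d j)                ≈⟨ Σ<-*ʳ n _ _ ⟩
            eval₁ n′ rowPoly x * P d j                               ∎
            where
            x : Carrier
            x = j · 1#
            summand : ℕ → ℕ → Carrier
            summand k i = a (k , i) * term (k , i) (m ℕ.+ d) j

            term-≈0 : ∀ k i → i < m → term (k , i) (m ℕ.+ d) j ≈ 0#
            term-≈0 k i i<m = begin
              mulX^ i (δ^ k P) (m ℕ.+ d) j                   ≡⟨ ≡.cong (λ e → mulX^ i (δ^ k P) e j) m+d≡i+e ⟩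
              mulX^ i (δ^ k P) (i ℕ.+ ((m ∸ i) ℕ.+ d)) j     ≡⟨ mulX^-+ i _ j (δ^ k P) ⟩
              δ^ k P ((m ∸ i) ℕ.+ d) j                       ≈⟨ δ^-column k j P _ ⟩
              δ₁^ j k (column j P) ((m ∸ i) ℕ.+ d)           ≈⟨ δ₁^-Degree≤ j k d deg-j _ d<e ⟩
              0#                                             ∎
              where
              m+d≡i+e : m ℕ.+ d ≡ i ℕ.+ ((m ∸ i) ℕ.+ d)
              m+d≡i+e = ≡.trans (≡.sym (ℕₚ.m+[n∸m]≡n (ℕₚ.≤-trans (ℕₚ.<⇒≤ i<m) (ℕₚ.m≤m+n m d))))
                                (≡.cong (i ℕ.+_) (ℕₚ.+-∸-comm d (ℕₚ.<⇒≤ i<m)))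
              d<e : d < (m ∸ i) ℕ.+ d
              d<e = ℕₚ.+-monoˡ-< d (ℕₚ.m<n⇒0<n∸m i<m)

            term-top : ∀ k → term (k , m) (m ℕ.+ d) j ≈ x ^ k * P d j
            term-top k = trans (reflexive (mulX^-+ m d j (δ^ k P))) (trans (δ^-column k j P d) (δ₁^-top j k d (column j P) deg-j))

            only-row-m : ∀ k → k < n → Σ< (suc A) (summand k) ≈ a (k , m) * (x ^ k * P d j)
            only-row-m k k<n = trans (Σ<-single (suc A) m _ (s≤s m≤A) other-rows) (*-congˡ (term-top k))
              where
              other-rows : ∀ i → i < suc A → i ≢ m → summand k i ≈ 0#
              other-rows i i≤A i≢m with ℕₚ.<-cmp i m
              ... | tri< i<m _ _ = trans (*-congˡ (term-≈0 k i i<m)) (zeroʳ _)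
              ... | tri≈ _ i≡m _ = ⊥-elim (i≢m i≡m)
              ... | tri> _ _ m<i = trans (*-congʳ (above i m<i (ℕₚ.≤-pred i≤A) k k<n)) (zeroˡ _)

          rowPoly-root : ∀ j → j ∈ J → eval₁ n′ rowPoly (j · 1#) ≈ 0#
          rowPoly-root j j∈ with degree j j∈
          ... | d , _ , P[d]≉0 , deg-j = x*y≈0⇒x≈0 (trans (sym (coefficient-formula j d deg-j)) (L≋0 (m ℕ.+ d) j)) P[d]≉0

          rowPoly≋0 : rowPoly ≋ λ _ → 0#
          rowPoly≋0 = MultiplicityBound.many-roots⇒≋0 char0 0 n′ n′ ℕₚ.≤-refl rowPoly rowPoly-Degree≤ points distinct roots
                        (≡.subst (n′ <_) (≡.sym (totalOrder-simple J)) ℕₚ.≤-refl)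
            where
            points : List (Carrier × ℕ)
            points = map (λ j → j · 1# , 1) J
            distinct : DistinctPoints points
            distinct = AllPairsₚ.map⁺ (AllPairs.map (λ {j} {j′} j≢j′ e → j≢j′ (·1#-injective j j′ e)) unique)
            roots : All (RootOfOrder n′ 0 rowPoly) points
            roots = Allₚ.map⁺ (All.tabulate λ {j} j∈ → λ { zero _ → rowPoly-root j j∈ ; (suc σ) (s≤s ()) })
            totalOrder-simple : ∀ js → totalOrder (map (λ j → j · 1# , 1) js) ≡ length js
            totalOrder-simple []       = ≡.refl
            totalOrder-simple (j ∷ js) = ≡.cong suc (totalOrder-simple js)

          contradiction : ⊥
          contradiction = row≉0 (λ k k<n → trans (reflexive (≡.sym (rowPoly-< k k<n))) (rowPoly≋0 k))

        contradiction : ⊥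
        contradiction = ¬¬-greatest-counterexample RowZero A not-all-RowZero
          λ (m , m≤A , row≉0 , above) → TopRow.contradiction m m≤A row≉0 above

      contradiction : ⊥
      contradiction = LinearSystem.¬¬-nontrivial-solution (≡-dec ℕ._≟_ ℕ._≟_) equations unknowns
                        (Uniqueₚ.cartesianProduct⁺ (Uniqueₚ.upTo⁺ n) (Uniqueₚ.upTo⁺ (suc A))) fewer-equations coefficient
                        λ (a , nontrivial , solves) → Solution.contradiction a nontrivial solves

    -- Induction on the number of columns: zero columns are discarded, otherwise eliminate.
    no-vanishing-polynomial : ∀ f (J : List ℕ) → length J ≤ f → Unique J → (∀ j → j ∈ J → j ≤ D₁) → length J ℕ.* D₀ ≤ B₀ →
                              (P : Poly) → DegreeX≤ D₀ P → (∀ i j → j ∉ J → P i j ≈ 0#) → NonZeroPoly P →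
                              VanishesAtAll P → length J ℕ.* (D₀ ℕ.+ M) < sumFin M S ℕ.+ M → ⊥
    no-vanishing-polynomial f [] _ _ _ _ P _ support (i , j , P[i,j]≉0) _ _ = P[i,j]≉0 (support i j (λ ()))
    no-vanishing-polynomial (suc f) J@(j₀ ∷ J′) #J≤f unique J≤D₁ nD₀≤B₀ P deg support nonzero vanishes count =
      ¬¬-excluded-middle {A = ∃ λ j → j ∈ J × ColumnZero j P} λ where
          (no no-zero-column) →
            ¬¬-∀∈ J (λ j j∈ → ¬¬-degree D₀ (column j P) (λ i → deg i j) (λ P[j]≈0 → no-zero-column (j , j∈ , P[j]≈0)))
              λ degree → Eliminate.contradiction j₀ J′ unique J≤D₁ nD₀≤B₀ P deg support degree vanishes count
          (yes (j , j∈ , P[j]≈0)) → discard j j∈ P[j]≈0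
      where
      discard : ∀ j → j ∈ J → ColumnZero j P → ⊥
      discard j j∈ P[j]≈0 =
        no-vanishing-polynomial f J⁻ (ℕₚ.≤-pred (ℕₚ.≤-trans shorter #J≤f)) (Uniqueₚ.filter⁺ keep unique)
          (λ x x∈ → J≤D₁ x (proj₁ (∈-filter⁻ keep x∈))) (ℕₚ.≤-trans (ℕₚ.*-monoˡ-≤ D₀ (ℕₚ.<⇒≤ shorter)) nD₀≤B₀)
          P deg support⁻ nonzero vanishes (ℕₚ.≤-<-trans (ℕₚ.*-monoˡ-≤ (D₀ ℕ.+ M) (ℕₚ.<⇒≤ shorter)) count)
        where
        keep : ∀ x → Dec (x ≢ j)
        keep x = ¬? (x ℕ.≟ j)
        J⁻ : List ℕ
        J⁻ = filter keep J
        shorter : length J⁻ < length J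
        shorter = Listₚ.filter-notAll keep J (Any.map (λ j≡x j≢x → j≢x (≡.sym j≡x)) j∈)
        support⁻ : ∀ i x → x ∉ J⁻ → P i x ≈ 0#
        support⁻ i x x∉J⁻ with x ℕ.≟ j
        ... | yes ≡.refl = P[j]≈0 i
        ... | no  x≢j    = support i x (λ x∈J → x∉J⁻ (∈-filter⁺ keep x∈J x≢j))

open import Level using (Level)
open import Data.Nat using (ℕ; _+_; _*_; _∸_; _<_; NonZero)
open import Data.Nat using () renaming (_<_ to _ℕ<_)
open import Data.Fin using (Fin)
open import Data.Product using (Σ; _×_)
open import Relation.Nullary using (¬_)
open import Relation.Binary.PropositionalEquality using (_≡_)

open import Data.Nat using (suc; s≤s)
open import Data.Nat.Properties using (≤-reflexive; ≤-pred; ≰⇒>; m≤m+n)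
open import Data.Product using (_,_)
open import Data.Sum using (inj₁; inj₂)
open import Data.List using (length; upTo)
open import Data.List.Properties using (length-upTo)
open import Data.List.Membership.Propositional using (_∉_)
open import Data.List.Membership.Propositional.Properties using (∈-upTo⁺; ∈-upTo⁻)
open import Data.List.Relation.Unary.Unique.Propositional.Properties using (upTo⁺)
open import Relation.Binary.PropositionalEquality using (cong; subst; sym)

proposition1 : ∀ {c ℓ} (K : Field c ℓ) →
  (M : ℕ) → .{{NonZero M}} → (D₀ D₁ : ℕ) → (S : Fin M → ℕ) →
  ((D₀ + M) * (D₁ + 1) ∸ M < sumFin M S) →
  let open FieldDefs K in
  CharZero →
  (ζ η : Fin M → Carrier) →
  (∀ κ → ¬ (η κ ≈ 0#)) →
  (∀ κ κ′ → ζ κ ≈ ζ κ′ → κ ≡ κ′) →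
  ¬ (Σ Poly λ P → DegBound D₀ D₁ P × NonZeroPoly P ×
      (∀ (κ : Fin M) (σ : ℕ) → σ ℕ< S κ → eval D₀ D₁ (δ^ σ P) (ζ κ) (η κ) ≈ 0#))
proposition1 K M D₀ D₁ S count char0 ζ η η≉0 ζ-injective (P , deg , nonzero , vanishes) =
  no-vanishing-polynomial (suc D₁) (upTo (suc D₁)) (≤-reflexive #columns) (upTo⁺ _) (λ j j∈ → ≤-pred (∈-upTo⁻ j∈))
    (≤-reflexive (cong (_* D₀) #columns)) P degX support nonzero
    (λ κ → V.VanishesTo-from-eval κ D₀ (S κ) P degX (m≤m+n D₀ _) (vanishes κ))
    (subst (λ n → n * (D₀ + M) < sumFin M S + M) (sym #columns) (Counting.column-count D₀ D₁ M (sumFin M S) count))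
  where
  open FieldDefs K using (_≈_; 0#)
  open ZeroEstimate K
  open Elimination char0 M D₀ D₁ (suc D₁ * D₀) S ζ η η≉0 ζ-injective
  #columns : length (upTo (suc D₁)) ≡ suc D₁
  #columns = length-upTo (suc D₁)
  degX : DegreeX≤ D₀ P
  degX i j D₀<i = deg i j (inj₁ D₀<i)
  support : ∀ i j → j ∉ upTo (suc D₁) → P i j ≈ 0#
  support i j j∉ = deg i j (inj₂ (≰⇒> (λ j≤D₁ → j∉ (∈-upTo⁺ (s≤s j≤D₁)))))
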